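{- For any integer $s\ge3$ and any constant $c>1/(s-1)$ we have, as $n\to\infty$, \[g(n;s,cn)=\big(1-O(1/n)\big)\,\mathrm{RT}(s,cn,n).\]
   Context: A red/blue/purple colouring of $K_n$ is a partition $R\cup B\cup P$ of its edge set. For integers $s,t\ge2$ and $n<R(s,t)$, $g(n;s,t)$ is the largest integer $g$ such that some red/blue/purple colouring of $K_n$ has $|P|=g$, $R\cup P$ is $K_s$-free and $B\cup P$ is $K_t$-free; for non-integer arguments $g(n;s,t):=g(n;\lceil s\rceil,\lceil t\rceil)$. $\mathrm{RT}(s,t,n)$ is the maximum number of edges in an $n$-vertex $K_s$-free graph with independence number less than $t$. -}

module Defs where

open import Data.Nat using (ℕ; zero; suc; _<_; _<ᵇ_)
open import Data.Bool using (Bool; true; false; not)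
open import Data.Fin using (Fin; toℕ)
open import Data.List using (List; length; map; concatMap; filterᵇ; allFin)
open import Data.Product using (Σ; _×_; _,_; proj₁; proj₂; ∃)
open import Data.Integer using (+_)
open import Data.Rational using (ℚ; _/_; _<_)
open import Relation.Binary.PropositionalEquality using (_≡_; _≢_)
open import Relation.Nullary using (¬_)
open import Function.Definitions using (Injective)

-- Graphs on vertex set Fin n: symmetric Bool-valued adjacency
-- (only pairs of distinct vertices matter).

Graph : ℕ → Set
Graph n = Fin n → Fin n → Bool

Symmetric : ∀ {n} → Graph n → Set
Symmetric G = ∀ i j → G i j ≡ G j i

-- unordered pairs {i,j} with i < j
orderedPairs : (n : ℕ) → List (Fin n × Fin n)
orderedPairs n =
  concatMap (λ i → map (i ,_) (filterᵇ (λ j → toℕ i <ᵇ toℕ j) (allFin n))) (allFin n)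

edgeCount : ∀ {n} → Graph n → ℕ
edgeCount {n} G = length (filterᵇ (λ p → G (proj₁ p) (proj₂ p)) (orderedPairs n))

HasClique : ∀ {n} → Graph n → ℕ → Set
HasClique {n} G s =
  Σ (Fin s → Fin n) λ f → Injective _≡_ _≡_ f × (∀ a b → a ≢ b → G (f a) (f b) ≡ true)

KFree : ∀ {n} → Graph n → ℕ → Set
KFree G s = ¬ HasClique G s

HasIndep : ∀ {n} → Graph n → ℕ → Set
HasIndep {n} G t =
  Σ (Fin t → Fin n) λ f → Injective _≡_ _≡_ f × (∀ a b → a ≢ b → G (f a) (f b) ≡ false)

-- RT(s,t,n): maximum number of edges of an n-vertex K_s-free graph with
-- independence number < t.  IsRT n s t r  :⇔  r is that maximum.

RTAdmissible : ∀ {n} → Graph n → ℕ → ℕ → Set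
RTAdmissible G s t = Symmetric G × KFree G s × ¬ HasIndep G t

IsRT : ℕ → ℕ → ℕ → ℕ → Set
IsRT n s t r =
  (Σ (Graph n) λ G → RTAdmissible G s t × edgeCount G ≡ r)
  × (∀ (G : Graph n) → RTAdmissible G s t → edgeCount G Data.Nat.≤ r)

data Colour : Set where
  red blue purple : Colour

isRed isBlue isPurple : Colour → Bool
isRed red = true
isRed _ = false
isBlue blue = true
isBlue _ = false
isPurple purple = true
isPurple _ = false

Colouring : ℕ → Set
Colouring n = Fin n → Fin n → Colour

RP BP PP : ∀ {n} → Colouring n → Graph n
RP col i j = not (isBlue (col i j))
BP col i j = not (isRed (col i j))
PP col i j = isPurple (col i j)

GAdmissible : ∀ {n} → Colouring n → ℕ → ℕ → Set
GAdmissible col s t = (∀ i j → col i j ≡ col j i) × KFree (RP col) s × KFree (BP col) t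

-- IsG n s t g  :⇔  g = g(n;s,t) (largest |P| over admissible colourings)
IsG : ℕ → ℕ → ℕ → ℕ → Set
IsG n s t g =
  (Σ (Colouring n) λ col → GAdmissible col s t × edgeCount (PP col) ≡ g)
  × (∀ (col : Colouring n) → GAdmissible col s t → edgeCount (PP col) Data.Nat.≤ g)

-- Real numbers as Dedekind lower cuts of ℚ:  L q  ⇔  q < c.

record Real : Set₁ where
  field
    L         : ℚ → Set
    inhabited : ∃ λ q → L q
    bounded   : ∃ λ q → ¬ L q
    downward  : ∀ {p q} → p Data.Rational.< q → L q → L p
    open-up   : ∀ {q} → L q → ∃ λ r → q Data.Rational.< r × L r
open Real public

-- 1/k as a rational (k ≥ 1; value at 0 irrelevant)
inv : ℕ → ℚ
inv zero = + 0 / 1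
inv (suc k) = + 1 / suc k

frac : ℕ → ℕ → ℚ
frac m zero = + 0 / 1
frac m (suc k) = + m / suc k

-- IsCeil c n m  :⇔  m = ⌈c·n⌉ for a real c > 0 and n ≥ 1:
-- c·n ≤ m (i.e. ¬ (m/n < c)) and every natural k < m has k/n < c.
IsCeil : Real → ℕ → ℕ → Set
IsCeil c n m = ¬ L c (frac m n) × (∀ k → k Data.Nat.< m → L c (frac k n))

{-# OPTIONS --safe #-}
-- Turán's theorem bounds RT(s,t,n) by (1 − 1/k) n²/2, where k = s − 1, and g(n;s,t) ≤ RT(s,t,n)
-- because R ∪ P of an admissible colouring is itself RT-admissible: its independent sets are blue
-- cliques. Conversely, write the vertices in a grid with k columns and colour a pair blue if it
-- shares a column, red if it shares a row and purple otherwise. Then R ∪ P is complete k-partite,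
-- a clique of B ∪ P meets every row at most once, and since c > 1/k the ceiling t of cn exceeds
-- the number n/k + 1 of rows once n is large. Each vertex misses at most n/k + 1 + k purple edges,
-- so g is within O(n) of the Turán bound, which is quadratic in n.
module Submission where

open import Data.Bool using (Bool; true; false; not; _∧_)
open import Data.Bool.Properties using (∧-identityʳ; ∧-zeroʳ)
open import Data.Fin using (Fin; toℕ; fromℕ<; _≟_) renaming (zero to fzero; suc to fsuc)
open import Data.Fin.Properties using (toℕ-injective; toℕ-fromℕ<; toℕ<n; pigeonhole)
  renaming (suc-injective to fsuc-injective; <⇒≢ to <⇒≢ᶠ)
import Data.Integer as ℤ
import Data.Integer.Properties as ℤ
open import Data.List using (List; []; _∷_; _++_; length; map; concatMap; filterᵇ; tabulate; allFin)
open import Data.List.Properties using (filter-++; length-++)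
open import Data.Nat using (ℕ; zero; suc; _+_; _*_; _∸_; _≤_; _<_; z≤n; s≤s; _<ᵇ_; NonZero; ∣_-_∣)
open import Data.Nat.DivMod using (_/_; _mod_; _divMod_; DivMod; /-monoˡ-≤; m/n*n≤m)
import Data.Nat.ListAction as List
open import Data.Nat.Properties hiding (_≟_)
open import Algebra.Properties.CommutativeSemigroup *-commutativeSemigroup using (x∙yz≈y∙xz)
open import Algebra.Properties.Semiring.Sum +-*-semiring
  using (sum-syntax; sum-cong-≗; sum-replicate-zero; ∑-distrib-+; ∑-comm; *-distribˡ-sum; *-distribʳ-sum)
open import Data.Nat.Tactic.RingSolver using (solve-∀)
open import Data.Product using (Σ; _×_; _,_; proj₁; proj₂; ∃; ∃₂)
open import Data.Rational using (mkℚ; ↥_; ↧_) renaming (_<_ to _<ℚ_; _≤_ to _≤ℚ_)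
import Data.Rational.Properties as ℚ
open import Data.Rational.Unnormalised using (mkℚᵘ)
import Data.Rational.Unnormalised as ℚᵘ
import Data.Rational.Unnormalised.Properties as ℚᵘ
open import Data.Sum using (_⊎_; inj₁; inj₂; [_,_]′)
open import Data.Vec.Functional using () renaming (_∷_ to _∷ᵛ_)
open import Function using (_∘_; id; flip)
open import Function.Definitions using (Injective)
open import Relation.Binary.Definitions using (tri<; tri≈; tri>)
open import Relation.Binary.PropositionalEquality
open import Relation.Nullary using (¬_; Dec; does; yes; no; contradiction)
open import Relation.Nullary.Decidable using (dec-true; dec-false; T?)
open import Defs

-- Sums of indicators

⟦_⟧ : Bool → ℕ
⟦ true ⟧ = 1
⟦ false ⟧ = 0

⟦∧⟧ : ∀ a b → ⟦ a ∧ b ⟧ ≡ ⟦ a ⟧ * ⟦ b ⟧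
⟦∧⟧ true b = sym (+-identityʳ ⟦ b ⟧)
⟦∧⟧ false b = refl

⟦∧⟧-monoʳ : ∀ a {b c} → (b ≡ true → c ≡ true) → ⟦ a ∧ b ⟧ ≤ ⟦ a ∧ c ⟧
⟦∧⟧-monoʳ false b⇒c = z≤n
⟦∧⟧-monoʳ true {false} b⇒c = z≤n
⟦∧⟧-monoʳ true {true} b⇒c rewrite b⇒c refl = ≤-refl

⟦⟧-split : ∀ a b → ⟦ b ⟧ ≡ ⟦ a ∧ b ⟧ + ⟦ not a ∧ b ⟧
⟦⟧-split true b = sym (+-identityʳ ⟦ b ⟧)
⟦⟧-split false b = refl

∧≡true : ∀ {a b} → a ∧ b ≡ true → a ≡ true × b ≡ true
∧≡true {true} {true} refl = refl , refl

does≡true : ∀ {A : Set} (a? : Dec A) → does a? ≡ true → A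
does≡true (yes a) refl = a

does-≟-sym : ∀ {n} (i j : Fin n) → does (i ≟ j) ≡ does (j ≟ i)
does-≟-sym i j with j ≟ i
... | yes j≡i = dec-true (i ≟ j) (sym j≡i)
... | no j≢i = dec-false (i ≟ j) (j≢i ∘ sym)

∑-mono-≤ : ∀ {n} {f g : Fin n → ℕ} → (∀ i → f i ≤ g i) → ∑[ i < n ] f i ≤ ∑[ i < n ] g i
∑-mono-≤ {zero} f≤g = z≤n
∑-mono-≤ {suc n} f≤g = +-mono-≤ (f≤g fzero) (∑-mono-≤ (f≤g ∘ fsuc))

∑-const : ∀ n c → ∑[ i < n ] c ≡ n * c
∑-const zero c = refl
∑-const (suc n) c = cong (c +_) (∑-const n c)

∑-zero : ∀ n {f : Fin n → ℕ} → (∀ i → f i ≡ 0) → ∑[ i < n ] f i ≡ 0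
∑-zero n f≡0 = trans (sum-cong-≗ f≡0) (sum-replicate-zero n)

∑-⟦≟⟧ : ∀ {m} (x : Fin m) → ∑[ y < m ] ⟦ does (x ≟ y) ⟧ ≡ 1
∑-⟦≟⟧ {suc m} fzero = cong suc (∑-zero m λ _ → refl)
∑-⟦≟⟧ (fsuc x) = ∑-⟦≟⟧ x

∑-⟦⟧≤1 : ∀ {n} (P : Fin n → Bool) → (∀ {i j} → P i ≡ true → P j ≡ true → i ≡ j) →
         ∑[ i < n ] ⟦ P i ⟧ ≤ 1
∑-⟦⟧≤1 {zero} P unique = z≤n
∑-⟦⟧≤1 {suc n} P unique with P fzero in P0
... | false = ∑-⟦⟧≤1 (P ∘ fsuc) λ Pi Pj → fsuc-injective (unique Pi Pj)
... | true = ≤-reflexive (cong suc (∑-zero n others))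
  where
    others : ∀ i → ⟦ P (fsuc i) ⟧ ≡ 0
    others i with P (fsuc i) in Pi
    ... | false = refl
    ... | true with () ← unique P0 Pi

∑-⟦⟧-≤-injectiveOn : ∀ {n m} (P : Fin n → Bool) (f : Fin n → Fin m) →
                     (∀ {i j} → P i ≡ true → P j ≡ true → f i ≡ f j → i ≡ j) →
                     ∑[ i < n ] ⟦ P i ⟧ ≤ m
∑-⟦⟧-≤-injectiveOn {n} {m} P f injective = begin
  ∑[ i < n ] ⟦ P i ⟧                               ≡⟨ sum-cong-≗ spread ⟩
  ∑[ i < n ] ∑[ y < m ] ⟦ P i ∧ does (f i ≟ y) ⟧   ≡⟨ ∑-comm {n} {m} _ ⟩
  ∑[ y < m ] ∑[ i < n ] ⟦ P i ∧ does (f i ≟ y) ⟧   ≤⟨ ∑-mono-≤ fibre≤1 ⟩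
  ∑[ y < m ] 1                                     ≡⟨ trans (∑-const m 1) (*-identityʳ m) ⟩
  m                                                ∎
  where
    open ≤-Reasoning
    spread : ∀ i → ⟦ P i ⟧ ≡ ∑[ y < m ] ⟦ P i ∧ does (f i ≟ y) ⟧
    spread i with P i
    ... | true = sym (∑-⟦≟⟧ (f i))
    ... | false = sym (∑-zero m λ _ → refl)
    fibre≤1 : ∀ y → ∑[ i < n ] ⟦ P i ∧ does (f i ≟ y) ⟧ ≤ 1
    fibre≤1 y = ∑-⟦⟧≤1 _ λ {i} {j} i∈ j∈ →
      let Pi , fi≡y = ∧≡true i∈ ; Pj , fj≡y = ∧≡true j∈
      in injective Pi Pj (trans (does≡true (f i ≟ y) fi≡y) (sym (does≡true (f j ≟ y) fj≡y)))

-- Counting edges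

countᵇ : ∀ {A : Set} → (A → Bool) → List A → ℕ
countᵇ p xs = length (filterᵇ p xs)

countᵇ-++ : ∀ {A : Set} (p : A → Bool) xs ys → countᵇ p (xs ++ ys) ≡ countᵇ p xs + countᵇ p ys
countᵇ-++ p xs ys = trans (cong length (filter-++ (T? ∘ p) xs ys)) (length-++ (filterᵇ p xs))

countᵇ-concatMap : ∀ {A B : Set} (p : B → Bool) (f : A → List B) xs →
                   countᵇ p (concatMap f xs) ≡ List.sum (map (countᵇ p ∘ f) xs)
countᵇ-concatMap p f [] = refl
countᵇ-concatMap p f (x ∷ xs) =
  trans (countᵇ-++ p (f x) (concatMap f xs)) (cong (countᵇ p (f x) +_) (countᵇ-concatMap p f xs))

countᵇ-map : ∀ {A B : Set} (p : B → Bool) (f : A → B) xs → countᵇ p (map f xs) ≡ countᵇ (p ∘ f) xs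
countᵇ-map p f [] = refl
countᵇ-map p f (x ∷ xs) with p (f x)
... | true = cong suc (countᵇ-map p f xs)
... | false = countᵇ-map p f xs

countᵇ-filterᵇ : ∀ {A : Set} (p q : A → Bool) xs → countᵇ p (filterᵇ q xs) ≡ countᵇ (λ x → q x ∧ p x) xs
countᵇ-filterᵇ p q [] = refl
countᵇ-filterᵇ p q (x ∷ xs) with q x
... | false = countᵇ-filterᵇ p q xs
... | true with p x
...   | true = cong suc (countᵇ-filterᵇ p q xs)
...   | false = countᵇ-filterᵇ p q xs

countᵇ-tabulate : ∀ {A : Set} {n} (p : A → Bool) (f : Fin n → A) →
                  countᵇ p (tabulate f) ≡ ∑[ i < n ] ⟦ p (f i) ⟧
countᵇ-tabulate {n = zero} p f = refl
countᵇ-tabulate {n = suc n} p f with p (f fzero)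
... | true = cong suc (countᵇ-tabulate p (f ∘ fsuc))
... | false = countᵇ-tabulate p (f ∘ fsuc)

sum-map-tabulate : ∀ {A : Set} {n} (h : A → ℕ) (f : Fin n → A) →
                   List.sum (map h (tabulate f)) ≡ ∑[ i < n ] h (f i)
sum-map-tabulate {n = zero} h f = refl
sum-map-tabulate {n = suc n} h f = cong (h (f fzero) +_) (sum-map-tabulate h (f ∘ fsuc))

_<ᶠ_ : ∀ {n} → Fin n → Fin n → Bool
i <ᶠ j = toℕ i <ᵇ toℕ j

edgeCount-∑ : ∀ {n} (G : Graph n) → edgeCount G ≡ ∑[ i < n ] ∑[ j < n ] ⟦ i <ᶠ j ∧ G i j ⟧
edgeCount-∑ {n} G = begin
  countᵇ edge (concatMap pairsFrom (allFin n))               ≡⟨ countᵇ-concatMap edge pairsFrom (allFin n) ⟩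
  List.sum (map (countᵇ edge ∘ pairsFrom) (allFin n))        ≡⟨ sum-map-tabulate (countᵇ edge ∘ pairsFrom) id ⟩
  ∑[ i < n ] countᵇ edge (pairsFrom i)                       ≡⟨ sum-cong-≗ rowCount ⟩
  ∑[ i < n ] ∑[ j < n ] ⟦ i <ᶠ j ∧ G i j ⟧                   ∎
  where
    open ≡-Reasoning
    edge : Fin n × Fin n → Bool
    edge (i , j) = G i j
    pairsFrom : Fin n → List (Fin n × Fin n)
    pairsFrom i = map (i ,_) (filterᵇ (i <ᶠ_) (allFin n))
    rowCount : ∀ i → countᵇ edge (pairsFrom i) ≡ ∑[ j < n ] ⟦ i <ᶠ j ∧ G i j ⟧
    rowCount i = begin
      countᵇ edge (pairsFrom i)                    ≡⟨ countᵇ-map edge (i ,_) (filterᵇ (i <ᶠ_) (allFin n)) ⟩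
      countᵇ (G i) (filterᵇ (i <ᶠ_) (allFin n))    ≡⟨ countᵇ-filterᵇ (G i) (i <ᶠ_) (allFin n) ⟩
      countᵇ (λ j → i <ᶠ j ∧ G i j) (allFin n)     ≡⟨ countᵇ-tabulate {n = n} (λ j → i <ᶠ j ∧ G i j) id ⟩
      ∑[ j < n ] ⟦ i <ᶠ j ∧ G i j ⟧                ∎

edgeCount-mono : ∀ {n} {G H : Graph n} → (∀ i j → G i j ≡ true → H i j ≡ true) → edgeCount G ≤ edgeCount H
edgeCount-mono {G = G} {H} G⊆H =
  subst₂ _≤_ (sym (edgeCount-∑ G)) (sym (edgeCount-∑ H))
    (∑-mono-≤ λ i → ∑-mono-≤ λ j → ⟦∧⟧-monoʳ (i <ᶠ j) (G⊆H i j))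

withoutLoops : ∀ {n} → Graph n → Graph n
withoutLoops G i j = not (does (i ≟ j)) ∧ G i j

withoutLoops-sym : ∀ {n} {G : Graph n} → Symmetric G → Symmetric (withoutLoops G)
withoutLoops-sym G-sym i j = cong₂ (λ a b → not a ∧ b) (does-≟-sym i j) (G-sym i j)

withoutLoops-irrefl : ∀ {n} (G : Graph n) i → withoutLoops G i i ≡ false
withoutLoops-irrefl G i = cong (λ a → not a ∧ G i i) (dec-true (i ≟ i) refl)

withoutLoops-≗ : ∀ {n} {G : Graph n} → (∀ i → G i i ≡ false) → ∀ i j → withoutLoops G i j ≡ G i j
withoutLoops-≗ G-irrefl i j with i ≟ j
... | yes refl = sym (G-irrefl i)
... | no _ = refl

<ᵇ-true : ∀ {m n} → m < n → (m <ᵇ n) ≡ true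
<ᵇ-true {m} {n} = dec-true (m <? n)

<ᵇ-false : ∀ {m n} → ¬ m < n → (m <ᵇ n) ≡ false
<ᵇ-false {m} {n} = dec-false (m <? n)

⟦≢∧⟧ : ∀ {n} (i j : Fin n) b → ⟦ not (does (i ≟ j)) ∧ b ⟧ ≡ ⟦ i <ᶠ j ∧ b ⟧ + ⟦ j <ᶠ i ∧ b ⟧
⟦≢∧⟧ i j b with <-cmp (toℕ i) (toℕ j)
... | tri< i<j i≢j j≮i rewrite dec-false (i ≟ j) (i≢j ∘ cong toℕ) | <ᵇ-true i<j | <ᵇ-false j≮i =
  sym (+-identityʳ ⟦ b ⟧)
... | tri≈ i≮j i≡j j≮i rewrite dec-true (i ≟ j) (toℕ-injective i≡j) | <ᵇ-false i≮j | <ᵇ-false j≮i = refl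
... | tri> i≮j i≢j j<i rewrite dec-false (i ≟ j) (i≢j ∘ cong toℕ) | <ᵇ-false i≮j | <ᵇ-true j<i = refl

handshake : ∀ {n} {G : Graph n} → Symmetric G → ∑[ i < n ] ∑[ j < n ] ⟦ withoutLoops G i j ⟧ ≡ 2 * edgeCount G
handshake {n} {G} G-sym = begin
  ∑[ i < n ] ∑[ j < n ] ⟦ withoutLoops G i j ⟧     ≡⟨ sum-cong-≗ split ⟩
  ∑[ i < n ] (∑[ j < n ] ⟦ i <ᶠ j ∧ G i j ⟧ + ∑[ j < n ] ⟦ j <ᶠ i ∧ G i j ⟧)
    ≡⟨ ∑-distrib-+ {n} _ _ ⟩
  E + ∑[ i < n ] ∑[ j < n ] ⟦ j <ᶠ i ∧ G i j ⟧     ≡⟨ cong (E +_) (∑-comm {n} {n} _) ⟩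
  E + ∑[ j < n ] ∑[ i < n ] ⟦ j <ᶠ i ∧ G i j ⟧     ≡⟨ cong (E +_) transposed ⟩
  E + E                                            ≡⟨ cong (λ e → e + e) (edgeCount-∑ G) ⟨
  edgeCount G + edgeCount G                        ≡⟨ cong (edgeCount G +_) (+-identityʳ _) ⟨
  2 * edgeCount G                                  ∎
  where
    open ≡-Reasoning
    E = ∑[ i < n ] ∑[ j < n ] ⟦ i <ᶠ j ∧ G i j ⟧
    split : ∀ i → ∑[ j < n ] ⟦ withoutLoops G i j ⟧
                  ≡ ∑[ j < n ] ⟦ i <ᶠ j ∧ G i j ⟧ + ∑[ j < n ] ⟦ j <ᶠ i ∧ G i j ⟧
    split i = trans (sum-cong-≗ λ j → ⟦≢∧⟧ i j (G i j)) (∑-distrib-+ {n} _ _)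
    transposed : ∑[ j < n ] ∑[ i < n ] ⟦ j <ᶠ i ∧ G i j ⟧ ≡ E
    transposed = sum-cong-≗ λ j → sum-cong-≗ λ i → cong (λ b → ⟦ j <ᶠ i ∧ b ⟧) (G-sym i j)

-- Turán's theorem

2xy≤x²+y² : ∀ x y → 2 * (x * y) ≤ x * x + y * y
2xy≤x²+y² x y = [ ordered , swapped ]′ (≤-total x y)
  where
    ordered : ∀ {x y} → x ≤ y → 2 * (x * y) ≤ x * x + y * y
    ordered {x} x≤y with d , refl ← m≤n⇒∃[o]m+o≡n x≤y =
      subst (2 * (x * (x + d)) ≤_) (identity x d) (m≤m+n _ (d * d))
      where
        identity : ∀ x d → 2 * (x * (x + d)) + d * d ≡ x * x + (x + d) * (x + d)
        identity = solve-∀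
    swapped : y ≤ x → 2 * (x * y) ≤ x * x + y * y
    swapped y≤x = subst₂ _≤_ (cong (2 *_) (*-comm y x)) (+-comm (y * y) (x * x)) (ordered y≤x)

-- With c = (1 + k) b:  (1 + k)² (a + b)² = (2 + k) k a² + 2 (2 + k) a c + (a − c)².
turán-step : ∀ k a b X Y → Y ≤ X + 2 * (b * a) → (1 + k) * X ≤ k * (a * a) →
             (2 + k) * Y ≤ (1 + k) * ((a + b) * (a + b))
turán-step k a b X Y Y≤ X≤ = *-cancelˡ-≤ (1 + k) (+-cancelʳ-≤ (2 * (a * c)) _ _ (begin
  (1 + k) * ((2 + k) * Y) + 2 * (a * c)                  ≤⟨ +-monoˡ-≤ (2 * (a * c)) scaled≤ ⟩
  (2 + k) * (k * (a * a)) + (2 + k) * (2 * (a * c)) + 2 * (a * c)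
    ≤⟨ +-monoʳ-≤ ((2 + k) * (k * (a * a)) + (2 + k) * (2 * (a * c))) (2xy≤x²+y² a c) ⟩
  (2 + k) * (k * (a * a)) + (2 + k) * (2 * (a * c)) + (a * a + c * c) ≡⟨ square-completion k a b ⟩
  (1 + k) * ((1 + k) * ((a + b) * (a + b))) + 2 * (a * c) ∎))
  where
    open ≤-Reasoning
    c = (1 + k) * b
    square-completion : ∀ k a b →
      (2 + k) * (k * (a * a)) + (2 + k) * (2 * (a * ((1 + k) * b))) + (a * a + ((1 + k) * b) * ((1 + k) * b))
      ≡ (1 + k) * ((1 + k) * ((a + b) * (a + b))) + 2 * (a * ((1 + k) * b))
    square-completion = solve-∀
    distribute : ∀ k X a b → (X + 2 * (b * a)) * (1 + k) ≡ (1 + k) * X + 2 * (a * ((1 + k) * b))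
    distribute = solve-∀
    scaled≤ : (1 + k) * ((2 + k) * Y) ≤ (2 + k) * (k * (a * a)) + (2 + k) * (2 * (a * c))
    scaled≤ = begin
      (1 + k) * ((2 + k) * Y)                ≡⟨ x∙yz≈y∙xz (1 + k) (2 + k) Y ⟩
      (2 + k) * ((1 + k) * Y)                ≡⟨ cong ((2 + k) *_) (*-comm (1 + k) Y) ⟩
      (2 + k) * (Y * (1 + k))                ≤⟨ *-monoʳ-≤ (2 + k) (*-monoˡ-≤ (1 + k) Y≤) ⟩
      (2 + k) * ((X + 2 * (b * a)) * (1 + k)) ≡⟨ cong ((2 + k) *_) (distribute k X a b) ⟩
      (2 + k) * ((1 + k) * X + 2 * (a * c))  ≤⟨ *-monoʳ-≤ (2 + k) (+-monoˡ-≤ (2 * (a * c)) X≤) ⟩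
      (2 + k) * (k * (a * a) + 2 * (a * c))  ≡⟨ *-distribˡ-+ (2 + k) (k * (a * a)) (2 * (a * c)) ⟩
      (2 + k) * (k * (a * a)) + (2 + k) * (2 * (a * c)) ∎

argmaxOn : ∀ {n} (S : Fin n → Bool) (h : Fin n → ℕ) →
           (∀ i → S i ≡ false) ⊎ ∃ λ v → S v ≡ true × (∀ i → S i ≡ true → h i ≤ h v)
argmaxOn {zero} S h = inj₁ λ ()
argmaxOn {suc n} S h with argmaxOn (S ∘ fsuc) (h ∘ fsuc) | S fzero in S0
... | inj₁ none | false = inj₁ λ { fzero → S0 ; (fsuc i) → none i }
... | inj₁ none | true =
  inj₂ (fzero , S0 , λ { fzero _ → ≤-refl ; (fsuc i) Si → contradiction (trans (sym Si) (none i)) λ () })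
... | inj₂ (v , Sv , max) | false =
  inj₂ (fsuc v , Sv , λ { fzero S0′ → contradiction (trans (sym S0′) S0) λ () ; (fsuc i) → max i })
... | inj₂ (v , Sv , max) | true with h fzero ≤? h (fsuc v)
...   | yes h0≤hv = inj₂ (fsuc v , Sv , λ { fzero _ → h0≤hv ; (fsuc i) → max i })
...   | no h0≰hv =
  inj₂ (fzero , S0 , λ { fzero _ → ≤-refl ; (fsuc i) Si → ≤-trans (max i Si) (<⇒≤ (≰⇒> h0≰hv)) })

module Turán {n : ℕ} (adj : Graph n) (adj-sym : Symmetric adj) where

  Clique : (Fin n → Bool) → ℕ → Set
  Clique S m = Σ (Fin m → Fin n) λ f → (∀ a → S (f a) ≡ true) × (∀ a b → a ≢ b → adj (f a) (f b) ≡ true)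

  size : (Fin n → Bool) → ℕ
  size S = ∑[ i < n ] ⟦ S i ⟧

  degreeIn : (Fin n → Bool) → Fin n → ℕ
  degreeIn S i = ∑[ j < n ] ⟦ adj i j ∧ S j ⟧

  arcs : (Fin n → Bool) → (Fin n → Bool) → ℕ
  arcs X Y = ∑[ i < n ] (⟦ X i ⟧ * degreeIn Y i)

  arcs-∑∑ : ∀ X Y → arcs X Y ≡ ∑[ i < n ] ∑[ j < n ] ⟦ X i ∧ (adj i j ∧ Y j) ⟧
  arcs-∑∑ X Y = sum-cong-≗ λ i →
    trans (*-distribˡ-sum {n} ⟦ X i ⟧ (λ j → ⟦ adj i j ∧ Y j ⟧)) (sum-cong-≗ {n} λ j → sym (⟦∧⟧ (X i) _))

  arcs-comm : ∀ X Y → arcs X Y ≡ arcs Y X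
  arcs-comm X Y = begin
    arcs X Y                                          ≡⟨ arcs-∑∑ X Y ⟩
    ∑[ i < n ] ∑[ j < n ] ⟦ X i ∧ (adj i j ∧ Y j) ⟧   ≡⟨ ∑-comm {n} {n} _ ⟩
    ∑[ j < n ] ∑[ i < n ] ⟦ X i ∧ (adj i j ∧ Y j) ⟧
      ≡⟨ sum-cong-≗ (λ j → sum-cong-≗ λ i → cong ⟦_⟧ (swap (X i) (Y j) (adj-sym i j))) ⟩
    ∑[ j < n ] ∑[ i < n ] ⟦ Y j ∧ (adj j i ∧ X i) ⟧   ≡⟨ arcs-∑∑ Y X ⟨
    arcs Y X                                          ∎
    where
      open ≡-Reasoning
      swap : ∀ x y {a b} → a ≡ b → x ∧ (a ∧ y) ≡ y ∧ (b ∧ x)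
      swap true true refl = trans (∧-identityʳ _) (sym (∧-identityʳ _))
      swap true false refl = ∧-zeroʳ _
      swap false true refl = sym (∧-zeroʳ _)
      swap false false refl = refl

  arcs-splitˡ : ∀ {X} X₁ X₂ Y → (∀ i → ⟦ X i ⟧ ≡ ⟦ X₁ i ⟧ + ⟦ X₂ i ⟧) →
                arcs X Y ≡ arcs X₁ Y + arcs X₂ Y
  arcs-splitˡ X₁ X₂ Y split =
    trans (sum-cong-≗ λ i → trans (cong (_* degreeIn Y i) (split i)) (*-distribʳ-+ (degreeIn Y i) ⟦ X₁ i ⟧ _))
          (∑-distrib-+ {n} _ _)

  arcs-monoʳ : ∀ X {Y Y′} → (∀ j → Y j ≡ true → Y′ j ≡ true) → arcs X Y ≤ arcs X Y′
  arcs-monoʳ X Y⊆Y′ =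
    ∑-mono-≤ λ i → *-monoʳ-≤ ⟦ X i ⟧ (∑-mono-≤ λ j → ⟦∧⟧-monoʳ (adj i j) (Y⊆Y′ j))

  arcs-≤-size*degree : ∀ {X Y} d → (∀ i → X i ≡ true → degreeIn Y i ≤ d) → arcs X Y ≤ size X * d
  arcs-≤-size*degree {X} {Y} d deg≤ = begin
    arcs X Y                    ≤⟨ ∑-mono-≤ term≤ ⟩
    ∑[ i < n ] (⟦ X i ⟧ * d)    ≡⟨ *-distribʳ-sum d (λ i → ⟦ X i ⟧) ⟨
    size X * d                  ∎
    where
      open ≤-Reasoning
      term≤ : ∀ i → ⟦ X i ⟧ * degreeIn Y i ≤ ⟦ X i ⟧ * d
      term≤ i with X i in Xi
      ... | true = *-monoʳ-≤ 1 (deg≤ i Xi)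
      ... | false = z≤n

  arcs-empty : ∀ {X} Y → (∀ i → X i ≡ false) → arcs X Y ≡ 0
  arcs-empty {X} Y empty = ∑-zero n λ i → cong (λ b → ⟦ b ⟧ * degreeIn Y i) (empty i)

  arcs-independent : ∀ S → ¬ Clique S 2 → arcs S S ≡ 0
  arcs-independent S no-edge = ∑-zero n term≡0
    where
      term≡0 : ∀ i → ⟦ S i ⟧ * degreeIn S i ≡ 0
      term≡0 i with S i in Si
      ... | false = refl
      ... | true = trans (+-identityʳ _) (∑-zero n edge≡0)
        where
          edge≡0 : ∀ j → ⟦ adj i j ∧ S j ⟧ ≡ 0
          edge≡0 j with adj i j in ij | S j in Sj
          ... | false | _ = refl
          ... | true | false = refl
          ... | true | true = contradiction (i ∷ᵛ (λ _ → j) , ∈S , adjacent) no-edge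
            where
              ∈S : ∀ a → S ((i ∷ᵛ (λ _ → j)) a) ≡ true
              ∈S fzero = Si
              ∈S (fsuc _) = Sj
              adjacent : ∀ a b → a ≢ b → adj ((i ∷ᵛ (λ _ → j)) a) ((i ∷ᵛ (λ _ → j)) b) ≡ true
              adjacent fzero fzero a≢b = contradiction refl a≢b
              adjacent fzero (fsuc fzero) _ = ij
              adjacent (fsuc fzero) fzero _ = trans (adj-sym j i) ij
              adjacent (fsuc fzero) (fsuc fzero) a≢b = contradiction refl a≢b

  extend-clique : ∀ {S v m} → S v ≡ true → Clique (λ j → adj v j ∧ S j) m → Clique S (suc m)
  extend-clique {S} {v} Sv (f , f∈N , f-adj) = v ∷ᵛ f , ∈S , adjacent
    where
      ∈S : ∀ a → S ((v ∷ᵛ f) a) ≡ true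
      ∈S fzero = Sv
      ∈S (fsuc a) = proj₂ (∧≡true (f∈N a))
      adjacent : ∀ a b → a ≢ b → adj ((v ∷ᵛ f) a) ((v ∷ᵛ f) b) ≡ true
      adjacent fzero fzero a≢b = contradiction refl a≢b
      adjacent fzero (fsuc b) _ = proj₁ (∧≡true (f∈N b))
      adjacent (fsuc a) fzero _ = trans (adj-sym (f a) v) (proj₁ (∧≡true (f∈N a)))
      adjacent (fsuc a) (fsuc b) a≢b = f-adj a b (a≢b ∘ cong fsuc)

  -- v has maximum degree in S: its neighbourhood N has no (2 + k)-clique, and every arc leaving
  -- M = S ∖ N starts at a vertex of degree at most ∣N∣.
  turán : ∀ k S → ¬ Clique S (2 + k) → (1 + k) * arcs S S ≤ k * (size S * size S)
  turán zero S no-edge = ≤-reflexive (trans (+-identityʳ _) (arcs-independent S no-edge))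
  turán (suc k) S no-clique with argmaxOn S (degreeIn S)
  ... | inj₁ empty = ≤-trans (≤-reflexive (trans (cong ((2 + k) *_) (arcs-empty S empty)) (*-zeroʳ (2 + k)))) z≤n
  ... | inj₂ (v , Sv , max) =
    subst (λ m → (2 + k) * arcs S S ≤ (1 + k) * (m * m)) (sym size-S)
      (turán-step k (size N) (size M) (arcs N N) (arcs S S) arcs≤ (turán k N (no-clique ∘ extend-clique Sv)))
    where
      N M : Fin n → Bool
      N j = adj v j ∧ S j
      M j = not (adj v j) ∧ S j
      split : ∀ j → ⟦ S j ⟧ ≡ ⟦ N j ⟧ + ⟦ M j ⟧
      split j = ⟦⟧-split (adj v j) (S j)
      size-S : size S ≡ size N + size M
      size-S = trans (sum-cong-≗ split) (∑-distrib-+ {n} _ _)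
      MS≤ : arcs M S ≤ size M * size N
      MS≤ = arcs-≤-size*degree {M} {S} (size N) λ i Mi → max i (proj₂ (∧≡true Mi))
      arcs≤ : arcs S S ≤ arcs N N + 2 * (size M * size N)
      arcs≤ = begin
        arcs S S                            ≡⟨ arcs-splitˡ N M S split ⟩
        arcs N S + arcs M S                 ≡⟨ cong (_+ arcs M S) (trans (arcs-comm N S) (arcs-splitˡ N M N split)) ⟩
        arcs N N + arcs M N + arcs M S      ≤⟨ +-monoˡ-≤ (arcs M S) (+-monoʳ-≤ (arcs N N) (arcs-monoʳ M {N} {S} N⊆S)) ⟩
        arcs N N + arcs M S + arcs M S      ≡⟨ +-assoc (arcs N N) (arcs M S) (arcs M S) ⟩
        arcs N N + (arcs M S + arcs M S)    ≤⟨ +-monoʳ-≤ (arcs N N) (+-mono-≤ MS≤ MS≤) ⟩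
        arcs N N + (size M * size N + size M * size N)
          ≡⟨ cong (λ x → arcs N N + (size M * size N + x)) (+-identityʳ _) ⟨
        arcs N N + 2 * (size M * size N)    ∎
        where
          open ≤-Reasoning
          N⊆S : ∀ j → N j ≡ true → S j ≡ true
          N⊆S j Nj = proj₂ (∧≡true Nj)

turán-edgeCount : ∀ {n} k {G : Graph n} → Symmetric G → KFree G (2 + k) → (1 + k) * (2 * edgeCount G) ≤ k * (n * n)
turán-edgeCount {n} k {G} G-sym G-free =
  subst₂ (λ e m → (1 + k) * e ≤ k * (m * m)) arcs≡ size≡ (turán k all no-clique)
  where
    open Turán (withoutLoops G) (withoutLoops-sym G-sym)
    all : Fin n → Bool
    all _ = true
    arcs≡ : arcs all all ≡ 2 * edgeCount G
    arcs≡ = trans (sum-cong-≗ {n} λ i → trans (+-identityʳ _) (sum-cong-≗ {n} λ j → cong ⟦_⟧ (∧-identityʳ _)))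
                  (handshake G-sym)
    size≡ : size all ≡ n
    size≡ = trans (∑-const n 1) (*-identityʳ n)
    no-clique : ¬ Clique all (2 + k)
    no-clique (f , _ , adjacent) = G-free (f , injective , λ a b a≢b → proj₂ (∧≡true (adjacent a b a≢b)))
      where
        injective : Injective _≡_ _≡_ f
        injective {a} {b} fa≡fb with a ≟ b
        ... | yes a≡b = a≡b
        ... | no a≢b = contradiction
          (trans (sym (adjacent a b a≢b)) (trans (cong (withoutLoops G (f a)) (sym fa≡fb)) (withoutLoops-irrefl G (f a))))
          λ ()

RT-turán : ∀ {n} k {t r} → IsRT n (2 + k) t r → (1 + k) * (2 * r) ≤ k * (n * n)
RT-turán k ((G , (G-sym , G-free , _) , refl) , _) = turán-edgeCount k G-sym G-free

-- Colourings

RP-admissible : ∀ {n s t} {col : Colouring n} → GAdmissible col s t → RTAdmissible (RP col) s t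
RP-admissible {col = col} (col-sym , RP-free , BP-free) =
  (λ i j → cong (not ∘ isBlue) (col-sym i j)) ,
  RP-free ,
  λ (f , f-inj , independent) → BP-free (f , f-inj , λ a b a≢b → blue-in-BP (col (f a) (f b)) (independent a b a≢b))
  where
    blue-in-BP : ∀ c → not (isBlue c) ≡ false → not (isRed c) ≡ true
    blue-in-BP blue _ = refl

g≤RT : ∀ {n s t g r} → IsG n s t g → IsRT n s t r → g ≤ r
g≤RT ((col , admissible , refl) , _) (_ , RT-max) =
  ≤-trans (edgeCount-mono λ i j → purple-in-RP (col i j)) (RT-max (RP col) (RP-admissible admissible))
  where
    purple-in-RP : ∀ c → isPurple c ≡ true → not (isBlue c) ≡ true
    purple-in-RP purple _ = refl

KFree-of-fibres : ∀ {n m t} {G : Graph n} (h : Fin n → Fin m) →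
                  (∀ {i j} → i ≢ j → h i ≡ h j → G i j ≡ false) → m < t → KFree G t
KFree-of-fibres h fibre-independent m<t (f , f-inj , clique)
  with a , b , a<b , hfa≡hfb ← pigeonhole m<t (h ∘ f) =
  contradiction (trans (sym (clique a b (<⇒≢ᶠ a<b))) (fibre-independent (<⇒≢ᶠ a<b ∘ f-inj) hfa≡hfb)) λ ()

module Grid (k : ℕ) .{{_ : NonZero k}} (n : ℕ) where

  rows : ℕ
  rows = suc (n / k)

  row< : ∀ i → toℕ i / k < rows
  row< i = s≤s (/-monoˡ-≤ k (<⇒≤ (toℕ<n i)))

  row : Fin n → Fin rows
  row i = fromℕ< (row< i)

  column : Fin n → Fin k
  column i = toℕ i mod k

  grid-injective : ∀ {i j} → column i ≡ column j → row i ≡ row j → i ≡ j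
  grid-injective {i} {j} c≡ r≡ = toℕ-injective (begin
    toℕ i                              ≡⟨ position i ⟩
    toℕ (column i) + toℕ (row i) * k   ≡⟨ cong₂ (λ c r → toℕ c + toℕ r * k) c≡ r≡ ⟩
    toℕ (column j) + toℕ (row j) * k   ≡⟨ position j ⟨
    toℕ j                              ∎)
    where
      open ≡-Reasoning
      position : ∀ i → toℕ i ≡ toℕ (column i) + toℕ (row i) * k
      position i = trans (DivMod.property (toℕ i divMod k))
                         (cong (λ q → toℕ (column i) + q * k) (sym (toℕ-fromℕ< (row< i))))

  colour : Bool → Bool → Colour
  colour true _ = blue
  colour false true = red
  colour false false = purple

  gridColouring : Colouring n
  gridColouring i j = colour (does (column i ≟ column j)) (does (row i ≟ row j))

  grid-sym : ∀ i j → gridColouring i j ≡ gridColouring j i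
  grid-sym i j = cong₂ colour (does-≟-sym (column i) (column j)) (does-≟-sym (row i) (row j))

  same-column⇒¬RP : ∀ {i j} → i ≢ j → column i ≡ column j → RP gridColouring i j ≡ false
  same-column⇒¬RP {i} {j} _ c≡ =
    cong (λ a → not (isBlue (colour a (does (row i ≟ row j))))) (dec-true (column i ≟ column j) c≡)

  same-row⇒¬BP : ∀ {i j} → i ≢ j → row i ≡ row j → BP gridColouring i j ≡ false
  same-row⇒¬BP {i} {j} i≢j r≡ =
    cong₂ (λ a b → not (isRed (colour a b)))
          (dec-false (column i ≟ column j) (i≢j ∘ flip grid-injective r≡)) (dec-true (row i ≟ row j) r≡)

  grid-admissible : ∀ t → rows < t → GAdmissible gridColouring (suc k) t
  grid-admissible t rows<t =
    grid-sym , KFree-of-fibres column same-column⇒¬RP ≤-refl , KFree-of-fibres row same-row⇒¬BP rows<t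

  column-class : ∀ i → ∑[ j < n ] ⟦ does (column i ≟ column j) ⟧ ≤ rows
  column-class i = ∑-⟦⟧-≤-injectiveOn _ row λ ci cj →
    grid-injective (trans (sym (does≡true (column i ≟ _) ci)) (does≡true (column i ≟ _) cj))

  row-class : ∀ i → ∑[ j < n ] ⟦ does (row i ≟ row j) ⟧ ≤ k
  row-class i = ∑-⟦⟧-≤-injectiveOn _ column λ ri rj c≡ →
    grid-injective c≡ (trans (sym (does≡true (row i ≟ _) ri)) (does≡true (row i ≟ _) rj))

  colour-covers : ∀ a b → 1 ≤ ⟦ isPurple (colour a b) ⟧ + ⟦ a ⟧ + ⟦ b ⟧
  colour-covers true b = s≤s z≤n
  colour-covers false true = s≤s z≤n
  colour-covers false false = s≤s z≤n

  purple-degree : ∀ i → n ≤ ∑[ j < n ] ⟦ PP gridColouring i j ⟧ + (rows + k)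
  purple-degree i = begin
    n                                                   ≡⟨ trans (∑-const n 1) (*-identityʳ n) ⟨
    ∑[ j < n ] 1                                        ≤⟨ ∑-mono-≤ (λ j → colour-covers (sameColumn j) (sameRow j)) ⟩
    ∑[ j < n ] (⟦ P j ⟧ + ⟦ sameColumn j ⟧ + ⟦ sameRow j ⟧)
      ≡⟨ trans (∑-distrib-+ {n} _ _) (cong (_+ ∑[ j < n ] ⟦ sameRow j ⟧) (∑-distrib-+ {n} _ _)) ⟩
    ∑[ j < n ] ⟦ P j ⟧ + ∑[ j < n ] ⟦ sameColumn j ⟧ + ∑[ j < n ] ⟦ sameRow j ⟧
      ≤⟨ +-mono-≤ (+-monoʳ-≤ (∑[ j < n ] ⟦ P j ⟧) (column-class i)) (row-class i) ⟩
    ∑[ j < n ] ⟦ P j ⟧ + rows + k                       ≡⟨ +-assoc (∑[ j < n ] ⟦ P j ⟧) rows k ⟩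
    ∑[ j < n ] ⟦ P j ⟧ + (rows + k)                     ∎
    where
      open ≤-Reasoning
      sameColumn sameRow P : Fin n → Bool
      sameColumn j = does (column i ≟ column j)
      sameRow j = does (row i ≟ row j)
      P = PP gridColouring i

  grid-purple : n * n ≤ 2 * edgeCount (PP gridColouring) + n * (rows + k)
  grid-purple = begin
    n * n                                                                   ≡⟨ ∑-const n n ⟨
    ∑[ i < n ] n                                                            ≤⟨ ∑-mono-≤ purple-degree ⟩
    ∑[ i < n ] (∑[ j < n ] ⟦ PP gridColouring i j ⟧ + (rows + k))           ≡⟨ ∑-distrib-+ {n} _ _ ⟩
    ∑[ i < n ] ∑[ j < n ] ⟦ PP gridColouring i j ⟧ + ∑[ i < n ] (rows + k)
      ≡⟨ cong₂ _+_ purple≡ (∑-const n (rows + k)) ⟩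
    2 * edgeCount (PP gridColouring) + n * (rows + k)                       ∎
    where
      open ≤-Reasoning
      P-irrefl : ∀ i → PP gridColouring i i ≡ false
      P-irrefl i = cong (λ a → isPurple (colour a (does (row i ≟ row i)))) (dec-true (column i ≟ column i) refl)
      purple≡ : ∑[ i < n ] ∑[ j < n ] ⟦ PP gridColouring i j ⟧ ≡ 2 * edgeCount (PP gridColouring)
      purple≡ = trans (sum-cong-≗ {n} λ i → sum-cong-≗ {n} λ j → cong ⟦_⟧ (sym (withoutLoops-≗ P-irrefl i j)))
                      (handshake (λ i j → cong isPurple (grid-sym i j)))

-- The ceiling of cn

frac<-cross : ∀ {a d} r → frac a (suc d) <ℚ r → ℤ.+ a ℤ.* ↧ r ℤ.< ↥ r ℤ.* ℤ.+ suc d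
frac<-cross {a} {d} r@record{} lt
  with ℚᵘ.*<* ad<rd ← ℚᵘ.<-respˡ-≃ (ℚ.toℚᵘ-fromℚᵘ (mkℚᵘ (ℤ.+ a) d)) (ℚ.toℚᵘ-mono-< lt) = ad<rd

frac≥-cross : ∀ {a d} r → r ≤ℚ frac a (suc d) → ↥ r ℤ.* ℤ.+ suc d ℤ.≤ ℤ.+ a ℤ.* ↧ r
frac≥-cross {a} {d} r@record{} le
  with ℚᵘ.*≤* rd≤ad ← ℚᵘ.≤-respʳ-≃ (ℚ.toℚᵘ-fromℚᵘ (mkℚᵘ (ℤ.+ a) d)) (ℚ.toℚᵘ-mono-≤ le) = rd≤ad

-- A rational p/D strictly between 1/K and c gives D K t ≥ p K n ≥ (D + 1) n.
ceiling-excess : ∀ (c : Real) k → L c (inv (suc k)) → ∀ m →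
                 ∃ λ N → ∀ n t → N ≤ n → ¬ L c (frac t n) → n + m ≤ suc k * t
ceiling-excess c k c>1/K m with open-up c c>1/K
... | mkℚ ℤ.-[1+ _ ] _ _ , 1/K<r , _ with () ← frac<-cross {1} {k} _ 1/K<r
... | mkℚ (ℤ.+ p) e _ , 1/K<r , Lr = suc (D * m) , excess
  where
    D K : ℕ
    D = suc e
    K = suc k
    D<pK : D < p * K
    D<pK = subst (_< p * K) (*-identityˡ D)
      (ℤ.drop‿+<+ (subst₂ ℤ._<_ (sym (ℤ.pos-* 1 D)) (sym (ℤ.pos-* p K)) (frac<-cross {1} {k} _ 1/K<r)))
    excess : ∀ n t → suc (D * m) ≤ n → ¬ L c (frac t n) → n + m ≤ K * t
    excess (suc n′) t (s≤s Dm≤n′) t/n≱c = *-cancelˡ-≤ D (begin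
      D * (n + m)      ≡⟨ *-distribˡ-+ D n m ⟩
      D * n + D * m    ≤⟨ +-monoʳ-≤ (D * n) (m≤n⇒m≤1+n Dm≤n′) ⟩
      D * n + n        ≡⟨ +-comm (D * n) n ⟩
      suc D * n        ≤⟨ *-monoˡ-≤ n D<pK ⟩
      p * K * n        ≡⟨ trans (cong (_* n) (*-comm p K)) (*-assoc K p n) ⟩
      K * (p * n)      ≤⟨ *-monoʳ-≤ K pn≤tD ⟩
      K * (t * D)      ≡⟨ trans (cong (K *_) (*-comm t D)) (x∙yz≈y∙xz K D t) ⟩
      D * (K * t)      ∎)
      where
        open ≤-Reasoning
        n = suc n′
        r≤t/n : mkℚ (ℤ.+ p) e _ ≤ℚ frac t n
        r≤t/n = ℚ.≮⇒≥ λ t/n<r → t/n≱c (downward c t/n<r Lr)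
        pn≤tD : p * n ≤ t * D
        pn≤tD = ℤ.drop‿+≤+
          (subst₂ ℤ._≤_ (sym (ℤ.pos-* p n)) (sym (ℤ.pos-* t D)) (frac≥-cross {t} {n′} _ r≤t/n))

-- Comparing the bounds

2+quotient≤ : ∀ k q n t → suc k * q ≤ n → n + 2 * suc k ≤ suc k * t → 2 + q ≤ t
2+quotient≤ k q n t kq≤n n+2k≤kt = *-cancelˡ-≤ (suc k) (begin
  suc k * (2 + q)          ≡⟨ *-distribˡ-+ (suc k) 2 q ⟩
  suc k * 2 + suc k * q    ≤⟨ +-mono-≤ (≤-reflexive (*-comm (suc k) 2)) kq≤n ⟩
  2 * suc k + n            ≡⟨ +-comm (2 * suc k) n ⟩
  n + 2 * suc k            ≤⟨ n+2k≤kt ⟩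
  suc k * t                ∎)
  where open ≤-Reasoning

grid-near-turán : ∀ j n q g → (2 + j) * q ≤ n → n * n ≤ 2 * g + n * (suc q + (2 + j)) →
                  (1 + j) * (n * n) ≤ (2 + j) * (2 * g) + n * ((2 + j) * (3 + j))
grid-near-turán j n q g kq≤n n²≤ = +-cancelʳ-≤ (n * n) _ _ (begin
  (1 + j) * (n * n) + n * n                                  ≡⟨ +-comm _ (n * n) ⟩
  (2 + j) * (n * n)                                          ≤⟨ *-monoʳ-≤ (2 + j) n²≤ ⟩
  (2 + j) * (2 * g + n * (suc q + (2 + j)))                  ≡⟨ expand j n q g ⟩
  (2 + j) * (2 * g) + n * ((2 + j) * (3 + j)) + n * ((2 + j) * q)
    ≤⟨ +-monoʳ-≤ ((2 + j) * (2 * g) + n * ((2 + j) * (3 + j))) (*-monoʳ-≤ n kq≤n) ⟩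
  (2 + j) * (2 * g) + n * ((2 + j) * (3 + j)) + n * n        ∎)
  where
    open ≤-Reasoning
    expand : ∀ j n q g → (2 + j) * (2 * g + n * (suc q + (2 + j)))
                         ≡ (2 + j) * (2 * g) + n * ((2 + j) * (3 + j)) + n * ((2 + j) * q)
    expand = solve-∀

turán-gap : ∀ j n g r → (2 + j) * (2 * r) ≤ (1 + j) * (n * n) →
            (1 + j) * (n * n) ≤ (2 + j) * (2 * g) + n * ((2 + j) * (3 + j)) →
            2 * r ≤ 2 * g + n * (3 + j)
turán-gap j n g r upper lower = *-cancelˡ-≤ (2 + j) (begin
  (2 + j) * (2 * r)                              ≤⟨ ≤-trans upper lower ⟩
  (2 + j) * (2 * g) + n * ((2 + j) * (3 + j))    ≡⟨ factor j n g ⟩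
  (2 + j) * (2 * g + n * (3 + j))                ∎)
  where
    open ≤-Reasoning
    factor : ∀ j n g → (2 + j) * (2 * g) + n * ((2 + j) * (3 + j)) ≡ (2 + j) * (2 * g + n * (3 + j))
    factor = solve-∀

RT-quadratic : ∀ j n g r → (1 + j) * (n * n) ≤ (2 + j) * (2 * g) + n * ((2 + j) * (3 + j)) → g ≤ r →
               2 * ((2 + j) * (3 + j)) ≤ n → n * n ≤ 4 * (2 + j) * r
RT-quadratic j n g r lower g≤r n-large = +-cancelʳ-≤ (n * n) _ _ (begin
  n * n + n * n                                          ≤⟨ m≤m+n (n * n + n * n) (2 * (j * (n * n))) ⟩
  n * n + n * n + 2 * (j * (n * n))                      ≡⟨ double j n ⟩
  2 * ((1 + j) * (n * n))
    ≤⟨ *-monoʳ-≤ 2 (≤-trans lower (+-monoˡ-≤ _ (*-monoʳ-≤ (2 + j) (*-monoʳ-≤ 2 g≤r)))) ⟩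
  2 * ((2 + j) * (2 * r) + n * ((2 + j) * (3 + j)))      ≡⟨ rearrange j n r ⟩
  4 * (2 + j) * r + n * (2 * ((2 + j) * (3 + j)))        ≤⟨ +-monoʳ-≤ (4 * (2 + j) * r) (*-monoʳ-≤ n n-large) ⟩
  4 * (2 + j) * r + n * n                                ∎)
  where
    open ≤-Reasoning
    double : ∀ j n → n * n + n * n + 2 * (j * (n * n)) ≡ 2 * ((1 + j) * (n * n))
    double = solve-∀
    rearrange : ∀ j n r → 2 * ((2 + j) * (2 * r) + n * ((2 + j) * (3 + j)))
                          ≡ 4 * (2 + j) * r + n * (2 * ((2 + j) * (3 + j)))
    rearrange = solve-∀

relative-gap : ∀ j n g r → 2 * r ≤ 2 * g + n * (3 + j) → n * n ≤ 4 * (2 + j) * r →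
               n * (r ∸ g) ≤ 2 * ((2 + j) * (3 + j)) * r
relative-gap j n g r gap quadratic = *-cancelˡ-≤ 2 (begin
  2 * (n * (r ∸ g))                  ≡⟨ x∙yz≈y∙xz 2 n (r ∸ g) ⟩
  n * (2 * (r ∸ g))                  ≡⟨ cong (n *_) (*-distribˡ-∸ 2 r g) ⟩
  n * (2 * r ∸ 2 * g)                ≤⟨ *-monoʳ-≤ n (m≤n+o⇒m∸n≤o (2 * r) (2 * g) gap) ⟩
  n * (n * (3 + j))                  ≡⟨ reassociate n (3 + j) ⟩
  (3 + j) * (n * n)                  ≤⟨ *-monoʳ-≤ (3 + j) quadratic ⟩
  (3 + j) * (4 * (2 + j) * r)        ≡⟨ rearrange j r ⟩
  2 * (2 * ((2 + j) * (3 + j)) * r)  ∎)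
  where
    open ≤-Reasoning
    reassociate : ∀ n m → n * (n * m) ≡ m * (n * n)
    reassociate = solve-∀
    rearrange : ∀ j r → (3 + j) * (4 * (2 + j) * r) ≡ 2 * (2 * ((2 + j) * (3 + j)) * r)
    rearrange = solve-∀

corollary2p4 : (s : ℕ) → 3 ≤ s → (c : Real) → L c (inv (s Data.Nat.∸ 1)) →
    ∃₂ λ (C N : ℕ) → ∀ n → N ≤ n → 1 ≤ n → ∀ t g r →
      IsCeil c n t → IsG n s t g → IsRT n s t r →
      n * ∣ g - r ∣ ≤ C * r
corollary2p4 (suc (suc (suc j))) (s≤s (s≤s (s≤s z≤n))) c c>1/K
  with N₀ , t-excess ← ceiling-excess c (suc j) c>1/K (2 * (2 + j)) = C , N₀ + C , bound
  where
    K = 2 + j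
    C = 2 * (K * (3 + j))
    bound : ∀ n → N₀ + C ≤ n → 1 ≤ n → ∀ t g r → IsCeil c n t → IsG n (1 + K) t g → IsRT n (1 + K) t r →
            n * ∣ g - r ∣ ≤ C * r
    bound n N≤n _ t g r (t/n≱c , _) isG isRT =
      subst (λ d → n * d ≤ C * r) (sym (m≤n⇒∣m-n∣≡n∸m g≤r))
        (relative-gap j n g r (turán-gap j n g r (RT-turán (suc j) isRT) lower)
                              (RT-quadratic j n g r lower g≤r (m+n≤o⇒n≤o N₀ N≤n)))
      where
        open Grid K n
        g≤r : g ≤ r
        g≤r = g≤RT isG isRT
        Kq≤n : K * (n / K) ≤ n
        Kq≤n = subst (_≤ n) (*-comm (n / K) K) (m/n*n≤m n K)
        rows<t : rows < t
        rows<t = 2+quotient≤ (suc j) (n / K) n t Kq≤n (t-excess n t (m+n≤o⇒m≤o N₀ N≤n) t/n≱c)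
        grid≤g : edgeCount (PP gridColouring) ≤ g
        grid≤g = proj₂ isG gridColouring (grid-admissible t rows<t)
        lower : (1 + j) * (n * n) ≤ K * (2 * g) + n * (K * (3 + j))
        lower = grid-near-turán j n (n / K) g Kq≤n
                  (≤-trans grid-purple (+-monoˡ-≤ (n * (rows + K)) (*-monoʳ-≤ 2 grid≤g)))
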